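{- Let $\Sigma$ be a bipartite graph with bipartition $X\cup Y$, let $\delta\in(0,1]$ and let $d,\Delta$ be integers such that $d(v)\in[\delta d,d]$ for all $v\in X\cup Y$, $d(v)\ge d(w)$ whenever $v\in X$, $w\in Y$ and $v\sim w$, and $|N(v)\cap N(w)|\le\Delta$ for all $v\neq w$. Then for every $A\subseteq X$, $$|\nabla(N(A),X\setminus[A])|\le d\,(|N(A)|-|[A]|).$$
   Context: $d(v)$ is the degree of $v$ in $\Sigma$ and $N(\cdot)$ denotes neighbourhood. For $A\subseteq X$, the closure is $[A]=\{v\in V(\Sigma):N(v)\subseteq N(A)\}$ (a subset of $X$ under the degree assumptions). For sets $P,Q$ of vertices, $\nabla(P,Q)$ is the set of edges $\{p,q\}$ of $\Sigma$ with $p\in P$, $q\in Q$.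
   Formalization: The parameter δ ranges over the rationals in (0,1]. -}

module Defs where

open import Data.Nat using (ℕ; zero; suc; _+_)
open import Data.Bool using (Bool; true; false; _∧_; _∨_; not; if_then_else_)
open import Data.Fin using (Fin; zero; suc)
open import Data.Sum using (_⊎_; inj₁; inj₂)
open import Function using (_∘_)

count : ∀ {k} → (Fin k → Bool) → ℕ
count {zero}  p = 0
count {suc k} p = (if p zero then 1 else 0) + count (p ∘ suc)

sumF : ∀ {k} → (Fin k → ℕ) → ℕ
sumF {zero}  f = 0
sumF {suc k} f = f zero + sumF (f ∘ suc)

anyF : ∀ {k} → (Fin k → Bool) → Bool
anyF {zero}  p = false
anyF {suc k} p = p zero ∨ anyF (p ∘ suc)

allF : ∀ {k} → (Fin k → Bool) → Bool
allF {zero}  p = true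
allF {suc k} p = p zero ∧ allF (p ∘ suc)

_⇒ᵇ_ : Bool → Bool → Bool
a ⇒ᵇ b = not a ∨ b

-- A finite simple bipartite graph Σ with parts X = Fin m and Y = Fin n,
-- given by its biadjacency relation E x y (x ∈ X, y ∈ Y).
-- Vertex set V(Σ) = X ⊎ Y.
V : ℕ → ℕ → Set
V m n = Fin m ⊎ Fin n

module Graph {m n : ℕ} (E : Fin m → Fin n → Bool) where

  adj : V m n → V m n → Bool
  adj (inj₁ x) (inj₂ y) = E x y
  adj (inj₂ y) (inj₁ x) = E x y
  adj (inj₁ _) (inj₁ _) = false
  adj (inj₂ _) (inj₂ _) = false

  VSet : Set
  VSet = V m n → Bool

  countV : VSet → ℕ
  countV p = count (p ∘ inj₁) + count (p ∘ inj₂)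

  anyV : VSet → Bool
  anyV p = anyF (p ∘ inj₁) ∨ anyF (p ∘ inj₂)

  allV : VSet → Bool
  allV p = allF (p ∘ inj₁) ∧ allF (p ∘ inj₂)

  deg : V m n → ℕ
  deg v = countV (adj v)

  isX : VSet
  isX (inj₁ _) = true
  isX (inj₂ _) = false

  liftX : (Fin m → Bool) → VSet
  liftX A (inj₁ x) = A x
  liftX A (inj₂ _) = false

  common : V m n → V m n → VSet
  common v w u = adj v u ∧ adj w u

  N : VSet → VSet
  N S u = anyV (λ s → S s ∧ adj s u)

  closure : (Fin m → Bool) → VSet
  closure A v = allV (λ u → adj v u ⇒ᵇ N (liftX A) u)

  Xminus : VSet → VSet
  Xminus S v = isX v ∧ not (S v)

  -- ∇(P,Q): number of edges {p,q} of Σ with p ∈ P, q ∈ Q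
  -- (every edge of Σ is {x,y} with x ∈ X, y ∈ Y, counted once)
  nabla : VSet → VSet → ℕ
  nabla P Q = sumF (λ x → count (λ y →
      E x y ∧ ((P (inj₁ x) ∧ Q (inj₂ y)) ∨ (P (inj₂ y) ∧ Q (inj₁ x)))))

-- Write C = [A] ∩ X and S = N(A) ⊆ Y. Every edge at a vertex of C ends in S, so
-- ∇(S, X ∖ C) = Σ_{y ∈ S} d(y) − Σ_{x ∈ C} d(x), and the claim becomes the deficiency inequality
-- Σ_{x ∈ C} (d − d(x)) ≤ Σ_{y ∈ S} (d − d(y)). Spread the deficiency d − d(v) of each vertex v
-- evenly over its d(v) edges. Along an edge xy with x ∈ C we have y ∈ S and d(y) ≤ d(x), so the
-- share of x is at most the share of y; summing over the edges at C, which are among the edges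
-- at S, gives the inequality. Since δ > 0, all degrees are positive when d > 0; in particular
-- no vertex of Y lies in [A].
module Submission where

open import Defs
open import Data.Nat using (ℕ; _≤_; zero; suc)
open import Data.Bool using (Bool; true; false; _∧_; _∨_; not; if_then_else_)
open import Data.Bool.Properties using (∧-conicalˡ; ∧-conicalʳ; ∧-zeroʳ; ∨-identityʳ; ¬-not)
open import Data.Fin using (Fin; zero; suc)
open import Data.Sum using (inj₁; inj₂)
open import Function using (_∘_)
open import Relation.Binary.PropositionalEquality
  using (_≡_; _≢_; refl; sym; trans; cong; cong₂; subst; subst₂; module ≡-Reasoning)

anyF-none : ∀ {k} {p : Fin k → Bool} → (∀ i → p i ≡ false) → anyF p ≡ false
anyF-none {zero}  none = refl
anyF-none {suc k} none = cong₂ _∨_ (none zero) (anyF-none (none ∘ suc))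

allF-true : ∀ {k} {p : Fin k → Bool} → allF p ≡ true → ∀ i → p i ≡ true
allF-true {p = p} all zero    = ∧-conicalˡ (p zero) _ all
allF-true {p = p} all (suc i) = allF-true (∧-conicalʳ (p zero) _ all) i

⇒ᵇ-mp : ∀ {a b} → a ≡ true → (a ⇒ᵇ b) ≡ true → b ≡ true
⇒ᵇ-mp refl a⇒b = a⇒b

⇒ᵇ-false : ∀ {a} → (a ⇒ᵇ false) ≡ true → a ≡ false
⇒ᵇ-false {false} _ = refl

-- ℕ arithmetic is opened only inside this block: the theorem at the end uses ℤ's _*_ and _-_.
module _ where
  open import Data.Nat using (_+_; _*_; _∸_; _<_; _!; z≤n; s≤s)
  open import Data.Nat.Properties
  open import Data.Nat.DivMod using (_/_; m/n*n≡m; /-monoʳ-≤)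
  open import Data.Nat.Divisibility using (_∣_; ∣-trans; m∣m*n; m≤n⇒m!∣n!)
  open import Data.Nat.Solver using (module +-*-Solver)
  open import Algebra.Properties.Semiring.Sum +-*-semiring
    using (sum; sum-cong-≗; sum-replicate-zero; ∑-comm; ∑-distrib-+; *-distribˡ-sum; *-distribʳ-sum)
  open +-*-Solver

  [_] : Bool → ℕ
  [ b ] = if b then 1 else 0

  ∑⟨_⟩ : ∀ {k} → (Fin k → Bool) → (Fin k → ℕ) → ℕ
  ∑⟨ P ⟩ f = sum (λ i → f i * [ P i ])

  sumF≡sum : ∀ {k} (f : Fin k → ℕ) → sumF f ≡ sum f
  sumF≡sum {zero}  f = refl
  sumF≡sum {suc k} f = cong (f zero +_) (sumF≡sum (f ∘ suc))

  count≡sum : ∀ {k} (p : Fin k → Bool) → count p ≡ sum (λ i → [ p i ])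
  count≡sum {zero}  p = refl
  count≡sum {suc k} p = cong ([ p zero ] +_) (count≡sum (p ∘ suc))

  sumF-count : ∀ {k l} (q : Fin k → Fin l → Bool) →
    sumF (λ x → count (q x)) ≡ sum (λ x → sum (λ y → [ q x y ]))
  sumF-count q = trans (sumF≡sum (λ x → count (q x))) (sum-cong-≗ (λ x → count≡sum (q x)))

  count-cong : ∀ {k} {p q : Fin k → Bool} → (∀ i → p i ≡ q i) → count p ≡ count q
  count-cong {p = p} {q} p≗q =
    trans (count≡sum p) (trans (sum-cong-≗ (cong [_] ∘ p≗q)) (sym (count≡sum q)))

  count-none : ∀ {k} {p : Fin k → Bool} → (∀ i → p i ≡ false) → count p ≡ 0
  count-none {k} none =
    trans (count-cong none) (trans (count≡sum {k} (λ _ → false)) (sum-replicate-zero k))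

  count-* : ∀ {k} (p : Fin k → Bool) c → count p * c ≡ sum (λ i → [ p i ] * c)
  count-* p c = trans (cong (_* c) (count≡sum p)) (*-distribʳ-sum c (λ i → [ p i ]))

  sum-mono-≤ : ∀ {k} {f g : Fin k → ℕ} → (∀ i → f i ≤ g i) → sum f ≤ sum g
  sum-mono-≤ {zero}  f≤g = z≤n
  sum-mono-≤ {suc k} f≤g = +-mono-≤ (f≤g zero) (sum-mono-≤ (f≤g ∘ suc))

  *-count-split : ∀ {k} D (P : Fin k → Bool) (f : Fin k → ℕ) → (∀ i → f i ≤ D) →
    D * count P ≡ ∑⟨ P ⟩ f + ∑⟨ P ⟩ (λ i → D ∸ f i)
  *-count-split D P f f≤D = begin
    D * count P                                           ≡⟨ cong (D *_) (count≡sum P) ⟩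
    D * sum (λ i → [ P i ])                               ≡⟨ *-distribˡ-sum D (λ i → [ P i ]) ⟩
    sum (λ i → D * [ P i ])                               ≡⟨ sum-cong-≗ split ⟩
    sum (λ i → f i * [ P i ] + (D ∸ f i) * [ P i ])       ≡⟨ ∑-distrib-+ (λ i → f i * [ P i ]) _ ⟩
    ∑⟨ P ⟩ f + ∑⟨ P ⟩ (λ i → D ∸ f i)                     ∎
    where
    open ≡-Reasoning
    split : ∀ i → D * [ P i ] ≡ f i * [ P i ] + (D ∸ f i) * [ P i ]
    split i = trans (cong (_* [ P i ]) (sym (m+[n∸m]≡n (f≤D i)))) (*-distribʳ-+ [ P i ] (f i) (D ∸ f i))

  ∑⟨⟩-0∸ : ∀ {k} (P : Fin k → Bool) (f : Fin k → ℕ) → ∑⟨ P ⟩ (λ i → 0 ∸ f i) ≡ 0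
  ∑⟨⟩-0∸ {k} P f = trans (sum-cong-≗ (λ i → cong (_* [ P i ]) (0∸n≡0 (f i)))) (sum-replicate-zero k)

  -- share D t = D! · (D − t) / t: a vertex of degree t spreads its deficiency D − t evenly over its
  -- t edges, scaled by D! to stay in ℕ. The value at t = 0 is a dummy.
  share : ℕ → ℕ → ℕ
  share D zero        = 0
  share D t@(suc _)   = (D ∸ t) * (D ! / t)

  *-share : ∀ {D t} → 0 < t → t ≤ D → t * share D t ≡ (D ∸ t) * D !
  *-share {D} {t@(suc s)} _ t≤D = begin
    t * ((D ∸ t) * (D ! / t))   ≡⟨ *-comm t ((D ∸ t) * (D ! / t)) ⟩
    (D ∸ t) * (D ! / t) * t     ≡⟨ *-assoc (D ∸ t) (D ! / t) t ⟩
    (D ∸ t) * (D ! / t * t)     ≡⟨ cong ((D ∸ t) *_) (m/n*n≡m t∣D!) ⟩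
    (D ∸ t) * D !               ∎
    where
    open ≡-Reasoning
    t∣D! : t ∣ D !
    t∣D! = ∣-trans (m∣m*n (s !)) (m≤n⇒m!∣n! t≤D)

  share-antitone : ∀ D {s t} → 0 < s → s ≤ t → share D t ≤ share D s
  share-antitone D {suc _} {suc _} _ s≤t = *-mono-≤ (∸-monoʳ-≤ D s≤t) (/-monoʳ-≤ (D !) s≤t)

  module Bipartite {m n : ℕ} (E : Fin m → Fin n → Bool) where

    degˣ : Fin m → ℕ
    degˣ x = count (E x)

    degʸ : Fin n → ℕ
    degʸ y = count (λ x → E x y)

    ∇ : (Fin n → Bool) → (Fin m → Bool) → ℕ
    ∇ S T = sum (λ x → sum (λ y → [ E x y ∧ (S y ∧ T x) ]))

    ∑-degˣ : (f : Fin m → ℕ) → sum (λ x → degˣ x * f x) ≡ sum (λ x → sum (λ y → [ E x y ] * f x))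
    ∑-degˣ f = sum-cong-≗ (λ x → count-* (E x) (f x))

    ∑-degʸ : (g : Fin n → ℕ) → sum (λ y → degʸ y * g y) ≡ sum (λ x → sum (λ y → [ E x y ] * g y))
    ∑-degʸ g = trans (sum-cong-≗ (λ y → count-* (λ x → E x y) (g y))) (∑-comm (λ y x → [ E x y ] * g y))

    double-counting : {f : Fin m → ℕ} {g : Fin n → ℕ} → (∀ x y → E x y ≡ true → f x ≤ g y) →
      sum (λ x → degˣ x * f x) ≤ sum (λ y → degʸ y * g y)
    double-counting {f} {g} f≤g = begin
      sum (λ x → degˣ x * f x)                   ≡⟨ ∑-degˣ f ⟩
      sum (λ x → sum (λ y → [ E x y ] * f x))    ≤⟨ sum-mono-≤ (λ x → sum-mono-≤ (along x)) ⟩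
      sum (λ x → sum (λ y → [ E x y ] * g y))    ≡⟨ ∑-degʸ g ⟨
      sum (λ y → degʸ y * g y)                   ∎
      where
      open ≤-Reasoning
      along : ∀ x y → [ E x y ] * f x ≤ [ E x y ] * g y
      along x y with E x y in e
      ... | true  = *-monoʳ-≤ 1 (f≤g x y e)
      ... | false = z≤n

    module _ {C : Fin m → Bool} {S : Fin n → Bool}
             (closed : ∀ x y → C x ≡ true → E x y ≡ true → S y ≡ true) where

      ∇-complement : ∇ S (not ∘ C) + ∑⟨ C ⟩ degˣ ≡ ∑⟨ S ⟩ degʸ
      ∇-complement = begin
        ∇ S (not ∘ C) + ∑⟨ C ⟩ degˣ
          ≡⟨ cong (∇ S (not ∘ C) +_) (∑-degˣ (λ x → [ C x ])) ⟩
        sum (λ x → sum (leaving x)) + sum (λ x → sum (atC x))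
          ≡⟨ ∑-distrib-+ (λ x → sum (leaving x)) (λ x → sum (atC x)) ⟨
        sum (λ x → sum (leaving x) + sum (atC x))
          ≡⟨ sum-cong-≗ (λ x → ∑-distrib-+ (leaving x) (atC x)) ⟨
        sum (λ x → sum (λ y → leaving x y + atC x y))
          ≡⟨ sum-cong-≗ (λ x → sum-cong-≗ (split x)) ⟩
        sum (λ x → sum (λ y → [ E x y ] * [ S y ]))
          ≡⟨ ∑-degʸ (λ y → [ S y ]) ⟨
        ∑⟨ S ⟩ degʸ ∎
        where
        open ≡-Reasoning
        leaving atC : Fin m → Fin n → ℕ
        leaving x y = [ E x y ∧ (S y ∧ not (C x)) ]
        atC x y = [ E x y ] * [ C x ]
        split : ∀ x y → leaving x y + atC x y ≡ [ E x y ] * [ S y ]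
        split x y with E x y in e | C x in c | S y in s
        ... | false | _     | _     = refl
        ... | true  | false | true  = refl
        ... | true  | false | false = refl
        ... | true  | true  | true  = refl
        ... | true  | true  | false with () ← trans (sym s) (closed x y c e)

      deficiency-≤ : (D : ℕ) → (∀ x → 0 < degˣ x) → (∀ y → 0 < degʸ y) →
        (∀ x → degˣ x ≤ D) → (∀ y → degʸ y ≤ D) → (∀ x y → E x y ≡ true → degʸ y ≤ degˣ x) →
        ∑⟨ C ⟩ (λ x → D ∸ degˣ x) ≤ ∑⟨ S ⟩ (λ y → D ∸ degʸ y)
      deficiency-≤ D posˣ posʸ ≤Dˣ ≤Dʸ mono = *-cancelˡ-≤ (D !) {{D !≢0}} (begin
        D ! * ∑⟨ C ⟩ (λ x → D ∸ degˣ x)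
          ≡⟨ *-distribˡ-sum (D !) (λ x → (D ∸ degˣ x) * [ C x ]) ⟩
        sum (λ x → D ! * ((D ∸ degˣ x) * [ C x ]))
          ≡⟨ sum-cong-≗ (λ x → spread (posˣ x) (≤Dˣ x) (C x)) ⟩
        sum (λ x → degˣ x * ([ C x ] * share D (degˣ x)))
          ≤⟨ double-counting along ⟩
        sum (λ y → degʸ y * ([ S y ] * share D (degʸ y)))
          ≡⟨ sum-cong-≗ (λ y → spread (posʸ y) (≤Dʸ y) (S y)) ⟨
        sum (λ y → D ! * ((D ∸ degʸ y) * [ S y ]))
          ≡⟨ *-distribˡ-sum (D !) (λ y → (D ∸ degʸ y) * [ S y ]) ⟨
        D ! * ∑⟨ S ⟩ (λ y → D ∸ degʸ y) ∎)
        where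
        open ≤-Reasoning
        spread : ∀ {t} → 0 < t → t ≤ D → ∀ b → D ! * ((D ∸ t) * [ b ]) ≡ t * ([ b ] * share D t)
        spread {t} t>0 t≤D b = begin-equality
          D ! * ((D ∸ t) * [ b ])   ≡⟨ solve 3 (λ k u v → k :* (u :* v) := v :* (u :* k)) refl (D !) (D ∸ t) [ b ] ⟩
          [ b ] * ((D ∸ t) * D !)   ≡⟨ cong ([ b ] *_) (*-share t>0 t≤D) ⟨
          [ b ] * (t * share D t)   ≡⟨ solve 3 (λ v u w → v :* (u :* w) := u :* (v :* w)) refl [ b ] t (share D t) ⟩
          t * ([ b ] * share D t)   ∎
        along : ∀ x y → E x y ≡ true → [ C x ] * share D (degˣ x) ≤ [ S y ] * share D (degʸ y)
        along x y e with C x in c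
        ... | false = z≤n
        ... | true rewrite closed x y c e = *-monoʳ-≤ 1 (share-antitone D (posʸ y) (mono x y e))

      ∇-bound : (D : ℕ) → (∀ x → degˣ x ≤ D) → (∀ y → degʸ y ≤ D) →
        ∑⟨ C ⟩ (λ x → D ∸ degˣ x) ≤ ∑⟨ S ⟩ (λ y → D ∸ degʸ y) →
        ∇ S (not ∘ C) + D * count C ≤ D * count S
      ∇-bound D ≤Dˣ ≤Dʸ deficiency = begin
        ∇ S (not ∘ C) + D * count C
          ≡⟨ cong (∇ S (not ∘ C) +_) (*-count-split D C degˣ ≤Dˣ) ⟩
        ∇ S (not ∘ C) + (∑⟨ C ⟩ degˣ + ∑⟨ C ⟩ (λ x → D ∸ degˣ x))
          ≡⟨ +-assoc (∇ S (not ∘ C)) (∑⟨ C ⟩ degˣ) (∑⟨ C ⟩ (λ x → D ∸ degˣ x)) ⟨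
        ∇ S (not ∘ C) + ∑⟨ C ⟩ degˣ + ∑⟨ C ⟩ (λ x → D ∸ degˣ x)
          ≡⟨ cong (_+ ∑⟨ C ⟩ (λ x → D ∸ degˣ x)) ∇-complement ⟩
        ∑⟨ S ⟩ degʸ + ∑⟨ C ⟩ (λ x → D ∸ degˣ x)
          ≤⟨ +-monoʳ-≤ (∑⟨ S ⟩ degʸ) deficiency ⟩
        ∑⟨ S ⟩ degʸ + ∑⟨ S ⟩ (λ y → D ∸ degʸ y)
          ≡⟨ *-count-split D S degʸ ≤Dʸ ⟨
        D * count S ∎
        where open ≤-Reasoning

  module Closure {m n : ℕ} (E : Fin m → Fin n → Bool) (A : Fin m → Bool) where
    open Graph E
    open Bipartite E

    NAʸ : Fin n → Bool
    NAʸ y = anyF (λ x → A x ∧ E x y)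

    [A]ˣ : Fin m → Bool
    [A]ˣ x = closure A (inj₁ x)

    deg-inj₁ : ∀ x → deg (inj₁ x) ≡ degˣ x
    deg-inj₁ x = cong (_+ degˣ x) (count-none {m} (λ _ → refl))

    deg-inj₂ : ∀ y → deg (inj₂ y) ≡ degʸ y
    deg-inj₂ y = trans (cong (degʸ y +_) (count-none {n} (λ _ → refl))) (+-identityʳ (degʸ y))

    onX : (P : ℕ → Set) → (∀ v → P (deg v)) → ∀ x → P (degˣ x)
    onX P h x = subst P (deg-inj₁ x) (h (inj₁ x))

    onY : (P : ℕ → Set) → (∀ v → P (deg v)) → ∀ y → P (degʸ y)
    onY P h y = subst P (deg-inj₂ y) (h (inj₂ y))

    N-inj₁ : ∀ x → N (liftX A) (inj₁ x) ≡ false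
    N-inj₁ x = cong₂ _∨_ (anyF-none (λ x′ → ∧-zeroʳ (A x′))) (anyF-none {n} (λ _ → refl))

    N-inj₂ : ∀ y → N (liftX A) (inj₂ y) ≡ NAʸ y
    N-inj₂ y = trans (cong (NAʸ y ∨_) (anyF-none {n} (λ _ → refl))) (∨-identityʳ (NAʸ y))

    [A]-closed : ∀ x y → [A]ˣ x ≡ true → E x y ≡ true → NAʸ y ≡ true
    [A]-closed x y x∈[A] e = trans (sym (N-inj₂ y)) (⇒ᵇ-mp e (allF-true (∧-conicalʳ _ _ x∈[A]) y))

    inj₂∈[A]⇒degʸ≡0 : ∀ y → closure A (inj₂ y) ≡ true → degʸ y ≡ 0
    inj₂∈[A]⇒degʸ≡0 y y∈[A] = count-none (λ x → ⇒ᵇ-false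
      (trans (cong (E x y ⇒ᵇ_) (sym (N-inj₁ x))) (allF-true (∧-conicalˡ _ _ y∈[A]) x)))

    nabla≡∇ : nabla (N (liftX A)) (Xminus (closure A)) ≡ ∇ NAʸ (not ∘ [A]ˣ)
    nabla≡∇ = trans (sumF-count crossing) (sum-cong-≗ (λ x → sum-cong-≗ (λ y → cong [_] (crossing≡ x y))))
      where
      crossing : Fin m → Fin n → Bool
      crossing x y = E x y ∧ ((N (liftX A) (inj₁ x) ∧ Xminus (closure A) (inj₂ y))
                              ∨ (N (liftX A) (inj₂ y) ∧ Xminus (closure A) (inj₁ x)))
      crossing≡ : ∀ x y → crossing x y ≡ (E x y ∧ (NAʸ y ∧ not ([A]ˣ x)))
      crossing≡ x y rewrite N-inj₁ x | N-inj₂ y = refl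

    countV-N : countV (N (liftX A)) ≡ count NAʸ
    countV-N = cong₂ _+_ (count-none N-inj₁) (count-cong N-inj₂)

    countV-closure : (∀ v → 0 < deg v) → countV (closure A) ≡ count [A]ˣ
    countV-closure deg>0 = trans (cong (count [A]ˣ +_) (count-none y∉[A])) (+-identityʳ (count [A]ˣ))
      where
      y∉[A] : ∀ y → closure A (inj₂ y) ≡ false
      y∉[A] y = ¬-not (λ y∈[A] → <⇒≢ (onY (0 <_) deg>0 y) (sym (inj₂∈[A]⇒degʸ≡0 y y∈[A])))

    nabla-bound : (D : ℕ) → (∀ v → deg v ≤ D) → (0 < D → ∀ v → 0 < deg v) →
      (∀ x y → E x y ≡ true → deg (inj₂ y) ≤ deg (inj₁ x)) →
      nabla (N (liftX A)) (Xminus (closure A)) + D * countV (closure A) ≤ D * countV (N (liftX A))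
    nabla-bound zero ≤D _ _ rewrite nabla≡∇ =
      ∇-bound [A]-closed 0 (onX (_≤ 0) ≤D) (onY (_≤ 0) ≤D)
        (≤-trans (≤-reflexive (∑⟨⟩-0∸ [A]ˣ degˣ)) z≤n)
    nabla-bound D@(suc _) ≤D pos mono rewrite nabla≡∇ | countV-N | countV-closure (pos (s≤s z≤n)) =
      ∇-bound [A]-closed D ≤Dˣ ≤Dʸ
        (deficiency-≤ [A]-closed D (onX (0 <_) deg>0) (onY (0 <_) deg>0) ≤Dˣ ≤Dʸ monoˣʸ)
      where
      deg>0 : ∀ v → 0 < deg v
      deg>0 = pos (s≤s z≤n)
      ≤Dˣ : ∀ x → degˣ x ≤ D
      ≤Dˣ = onX (_≤ D) ≤D
      ≤Dʸ : ∀ y → degʸ y ≤ D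
      ≤Dʸ = onY (_≤ D) ≤D
      monoˣʸ : ∀ x y → E x y ≡ true → degʸ y ≤ degˣ x
      monoˣʸ x y e = subst₂ _≤_ (deg-inj₂ y) (deg-inj₁ x) (mono x y e)

open import Data.Integer using (ℤ; +_; -[1+_]; -_; _⊖_; _-_; _*_; +≤+)
  renaming (_≤_ to _≤ℤ_; _+_ to _+ℤ_)
open import Data.Integer.Properties
  using (⊖-≥; [+m]-[+n]≡m⊖n; pos-*; *-distribˡ-+; neg-distribʳ-*; *-zeroʳ; drop‿+≤+)
  renaming (≤-reflexive to ≤ℤ-reflexive)
open import Data.Rational using (ℚ; 0ℚ; 1ℚ; _/_; positive)
  renaming (_<_ to _<ℚ_; _≤_ to _≤ℚ_; _*_ to _*ℚ_)
open import Data.Rational.Properties using (positive⁻¹; pos*pos⇒pos; normalize-pos; <-≤-trans; <-irrefl)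
open import Relation.Nullary using (contradiction)
import Data.Nat as ℕ
import Data.Nat.Properties as ℕ

m+o*p≤o*n⇒m≤o*[n-p] : ∀ m n o p → m ℕ.+ o ℕ.* p ≤ o ℕ.* n → + m ≤ℤ + o * (+ n - + p)
m+o*p≤o*n⇒m≤o*[n-p] m n o p le = subst (+ m ≤ℤ_) o*[n-p]≡ (+≤+ (ℕ.m+n≤o⇒m≤o∸n m le))
  where
  open ≡-Reasoning
  o*[n-p]≡ : + (o ℕ.* n ℕ.∸ o ℕ.* p) ≡ + o * (+ n - + p)
  o*[n-p]≡ = begin
    + (o ℕ.* n ℕ.∸ o ℕ.* p)       ≡⟨ ⊖-≥ (ℕ.m+n≤o⇒n≤o m le) ⟨
    o ℕ.* n ⊖ o ℕ.* p             ≡⟨ [+m]-[+n]≡m⊖n (o ℕ.* n) (o ℕ.* p) ⟨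
    + (o ℕ.* n) - + (o ℕ.* p)     ≡⟨ cong₂ _-_ (pos-* o n) (pos-* o p) ⟩
    + o * + n - + o * + p         ≡⟨ cong (+ o * + n +ℤ_) (neg-distribʳ-* (+ o) (+ p)) ⟩
    + o * + n +ℤ + o * - + p      ≡⟨ *-distribˡ-+ (+ o) (+ n) (- + p) ⟨
    + o * (+ n - + p)             ∎

scaled-bound⇒pos : ∀ {δ D t} → 0ℚ <ℚ δ → 0 ℕ.< D → δ *ℚ ((+ D) / 1) ≤ℚ ((+ t) / 1) → 0 ℕ.< t
scaled-bound⇒pos {t = ℕ.suc _} _ _ _ = ℕ.s≤s ℕ.z≤n
scaled-bound⇒pos {δ} {ℕ.suc D} {ℕ.zero} δ>0 _ δD≤0 = contradiction (<-≤-trans δD>0 δD≤0) (<-irrefl refl)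
  where
  δD>0 : 0ℚ <ℚ δ *ℚ ((+ ℕ.suc D) / 1)
  δD>0 = positive⁻¹ _ {{pos*pos⇒pos δ {{positive δ>0}} _ {{normalize-pos (ℕ.suc D) 1}}}}

proposition4p3 : (m n : ℕ) (E : Fin m → Fin n → Bool)
  (δ : ℚ) (d Δ : ℤ) →
  0ℚ <ℚ δ → δ ≤ℚ 1ℚ →
  (∀ v → (δ *ℚ (d / 1)) ≤ℚ ((+ Graph.deg E v) / 1)) →
  (∀ v → (+ Graph.deg E v) ≤ℤ d) →
  (∀ v w → Graph.isX E v ≡ true → Graph.isX E w ≡ false → Graph.adj E v w ≡ true →
    Graph.deg E w ≤ Graph.deg E v) →
  (∀ v w → v ≢ w → (+ Graph.countV E (Graph.common E v w)) ≤ℤ Δ) →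
  (A : Fin m → Bool) →
  (+ Graph.nabla E (Graph.N E (Graph.liftX E A)) (Graph.Xminus E (Graph.closure E A)))
    ≤ℤ (d * ((+ Graph.countV E (Graph.N E (Graph.liftX E A))) - (+ Graph.countV E (Graph.closure E A))))
proposition4p3 m n E δ (+ D) Δ δ>0 _ δD≤deg deg≤D mono _ A =
  m+o*p≤o*n⇒m≤o*[n-p] _ (countV (N (liftX A))) D (countV (closure A)) (nabla-bound D
    (λ v → drop‿+≤+ (deg≤D v))
    (λ D>0 v → scaled-bound⇒pos δ>0 D>0 (δD≤deg v))
    (λ x y → mono (inj₁ x) (inj₂ y) refl refl))
  where
  open Graph E
  open Closure E A
proposition4p3 (suc m) n E δ -[1+ k ] _ _ _ _ deg≤d _ _ A with () ← deg≤d (inj₁ zero)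
proposition4p3 zero (suc n) E δ -[1+ k ] _ _ _ _ deg≤d _ _ A with () ← deg≤d (inj₂ zero)
proposition4p3 zero zero E δ -[1+ k ] _ _ _ _ _ _ _ A = ≤ℤ-reflexive (sym (*-zeroʳ -[1+ k ]))
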